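{- Let $\Phi=(V,\mathcal{Q},\mathcal{C})$ be a CSP formula, $\sigma$ a feasible partial assignment and $v\in V$ such that $\sigma(v)=\star$ and $\mathbb{P}[\neg c\mid\sigma]\le p'q$ for all $c\in\mathcal{C}$. Then for every $u\in V$ that is not $\sigma$-fixed and every $a\in Q_u\cup\{\star\}$, the partial assignment $\sigma_{u\gets a}$ is feasible, satisfies $\sigma_{u\gets a}(v)=\star$, and satisfies $\mathbb{P}[\neg c\mid\sigma_{u\gets a}]\le p'q$ for all $c\in\mathcal{C}$.
   Context: A CSP formula $\Phi=(V,\mathcal{Q},\mathcal{C})$: finite variable set $V$; finite domains $Q_v$ with $q_v=|Q_v|\ge2$; finite set $\mathcal{C}$ of constraints $c$ with scope $\mathsf{vbl}(c)$ and $c:\bigotimes_{u\in\mathsf{vbl}(c)}Q_u\to\{\mathtt{True},\mathtt{False}\}$. $q=\max q_v$, $k=\max_c|\mathsf{vbl}(c)|$, $\Delta=\max_c|\{c':\mathsf{vbl}(c)\cap\mathsf{vbl}(c')\neq\emptyset\}|$ (counting $c$); $\mathbb{P}$ uniform product distribution. Partial assignment: $\sigma\in\bigotimes_v(Q_v\cup\{\star,\circ\})$ ($\star$: accessed, unassigned; $\circ$: unaccessed); $\Lambda(\sigma)=\{v:\sigma(v)\in Q_v\}$, $\Lambda^+(\sigma)=\{v:\sigma(v)\ne\circ\}$; $\sigma_{u\gets a}$ is $\sigma$ with the value at $u$ replaced by $a$; $\mathbb{P}[A\mid\sigma]$ conditions on agreement on $\Lambda(\sigma)$; $\sigma$ is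 feasible if some satisfying assignment of $\Phi$ agrees with it on $\Lambda(\sigma)$. Let $p'=(18\mathrm{e}^2q^2k\Delta^4)^{ -1}$. Fix a frozen-decision oracle which, given $c$ and $\sigma$, answers "yes" if $\mathbb{P}[\neg c\mid\sigma]>p'$, "no" if $\mathbb{P}[\neg c\mid\sigma]<0.99p'$, and otherwise arbitrarily but consistently (depending only on $c$ and $\sigma$ restricted to $\mathsf{vbl}(c)$). $c$ is $\sigma$-frozen if the oracle answers "yes". A variable $u$ is $\sigma$-fixed if $u\in\Lambda^+(\sigma)$ or $u\in\mathsf{vbl}(c)$ for some $\sigma$-frozen $c$. -}

module Defs where

open import Data.Nat using (ℕ; zero; suc; _+_; _*_; _^_; _≤_; _<_; _⊔_; _!; _≤?_)
open import Data.Fin using (Fin; _≟_) renaming (zero to fz; suc to fs)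
open import Data.Fin.Subset using (Subset; _∈_; _∩_; ∣_∣)
open import Data.List using (List; []; _∷_; map; concatMap; length; filter; filterᵇ; foldr; allFin)
open import Data.Bool.ListAction using (and)
open import Data.Sum using (_⊎_)
open import Data.Empty using (⊥)
open import Data.Bool using (Bool; true; false; _∧_; not)
open import Data.Product using (Σ; ∃; _×_; _,_)
open import Relation.Nullary using (yes; no)
open import Relation.Nullary.Decidable using (⌊_⌋)
open import Relation.Binary.PropositionalEquality using (_≡_; refl)
open import Function using (_∘_)

-- Comparisons of the form  A·e² ⋚ B  for natural numbers A, B,
-- stated exactly via the partial sums of e = Σ 1/i!.
-- S j = Σ_{i ≤ j} j!/i!, so s_j = S j / j! ↑ e (strictly below e),
-- and u_N = s_N + 1/(N·N!) = (S N · N + 1)/(N·N!) ↓ e (strictly above e), N ≥ 1.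

S : ℕ → ℕ
S zero    = 1
S (suc j) = suc j * S j + 1

-- A·e² ≤ B   (e = sup s_j)
_·e²≤_ : ℕ → ℕ → Set
A ·e²≤ B = ∀ j → A * (S j ^ 2) ≤ B * ((j !) ^ 2)

_·e²>_ : ℕ → ℕ → Set
A ·e²> B = ∃ λ j → B * ((j !) ^ 2) < A * (S j ^ 2)

-- A·e² < B   (e = inf u_N, N = j+1)
_·e²<_ : ℕ → ℕ → Set
A ·e²< B = ∃ λ j → A * ((S (suc j) * suc j + 1) ^ 2) < B * ((suc j * (suc j !)) ^ 2)

Assign : (n : ℕ) → (Fin n → ℕ) → Set
Assign n qs = (v : Fin n) → Fin (qs v)

private
  extend : ∀ {n} {qs : Fin (suc n) → ℕ} → Fin (qs fz) → Assign n (qs ∘ fs) → Assign (suc n) qs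
  extend a τ fz     = a
  extend a τ (fs v) = τ v

allAssign : (n : ℕ) (qs : Fin n → ℕ) → List (Assign n qs)
allAssign zero    qs = (λ ()) ∷ []
allAssign (suc n) qs =
  concatMap (λ a → map (extend a) (allAssign n (qs ∘ fs))) (allFin (qs fz))

record Constraint (n : ℕ) (qs : Fin n → ℕ) : Set where
  field
    vbl   : Subset n
    check : Assign n qs → Bool
    local : ∀ (τ τ' : Assign n qs) → (∀ w → w ∈ vbl → τ w ≡ τ' w) → check τ ≡ check τ'

record CSP : Set where
  field
    n     : ℕ
    qs    : Fin n → ℕ
    qs≥2  : ∀ v → 2 ≤ qs v
    m     : ℕ
    con   : Fin m → Constraint n qs

module _ (Φ : CSP) where
  open CSP Φ
  open Constraint

  qmax : ℕ
  qmax = foldr _⊔_ 0 (map qs (allFin n))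

  kmax : ℕ
  kmax = foldr _⊔_ 0 (map (λ c → ∣ vbl (con c) ∣) (allFin m))

  Δmax : ℕ
  Δmax = foldr _⊔_ 0 (map (λ c →
           length (filter (λ c' → 1 ≤? ∣ vbl (con c) ∩ vbl (con c') ∣) (allFin m)))
           (allFin m))

  -- 18·q²·k·Δ⁴  (so that p' = 1/(e² · K))
  K : ℕ
  K = 18 * (qmax ^ 2) * kmax * (Δmax ^ 4)

-- values of a partial assignment: a value in Q_v, ⋆ (accessed, unassigned),
-- or ∘ (unaccessed)
data PVal (k : ℕ) : Set where
  val   : Fin k → PVal k
  star  : PVal k
  unacc : PVal k

module _ (Φ : CSP) where
  open CSP Φ
  open Constraint

  PA : Set
  PA = (v : Fin n) → PVal (qs v)

  private
    okᵇ : ∀ {k} → PVal k → Fin k → Bool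
    okᵇ (val a) b = ⌊ a ≟ b ⌋
    okᵇ star    b = true
    okᵇ unacc   b = true

  agreesᵇ : PA → Assign n qs → Bool
  agreesᵇ σ τ = and (map (λ v → okᵇ (σ v) (τ v)) (allFin n))

  Agrees : PA → Assign n qs → Set
  Agrees σ τ = ∀ v a → σ v ≡ val a → τ v ≡ a

  Satisfies : Assign n qs → Set
  Satisfies τ = ∀ c → check (con c) τ ≡ true

  Feasible : PA → Set
  Feasible σ = Σ (Assign n qs) λ τ → Satisfies τ × Agrees σ τ

  -- P[¬c | σ] = bad c σ / total σ   (uniform product distribution)
  total : PA → ℕ
  total σ = length (filterᵇ (agreesᵇ σ) (allAssign n qs))

  bad : Fin m → PA → ℕ
  bad c σ = length (filterᵇ (λ τ → agreesᵇ σ τ ∧ not (check (con c) τ)) (allAssign n qs))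

  -- P[¬c | σ] ≤ p'·q   ⇔  bad·K·e² ≤ q·total
  ProbLe-p'q : Fin m → PA → Set
  ProbLe-p'q c σ = (bad c σ * K Φ) ·e²≤ (qmax Φ * total σ)

  -- P[¬c | σ] > p'     ⇔  bad·K·e² > total
  ProbGt-p' : Fin m → PA → Set
  ProbGt-p' c σ = (bad c σ * K Φ) ·e²> total σ

  -- P[¬c | σ] < 0.99 p' ⇔ 100·bad·K·e² < 99·total
  ProbLt-099p' : Fin m → PA → Set
  ProbLt-099p' c σ = (100 * bad c σ * K Φ) ·e²< (99 * total σ)

  record Oracle : Set where
    field
      frozen    : Fin m → PA → Bool
      yes-sound : ∀ c σ → ProbGt-p' c σ → frozen c σ ≡ true
      no-sound  : ∀ c σ → ProbLt-099p' c σ → frozen c σ ≡ false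
      consistent : ∀ c (σ σ' : PA) → (∀ w → w ∈ vbl (con c) → σ w ≡ σ' w) →
                   frozen c σ ≡ frozen c σ'

  open Oracle

  Fixed : Oracle → PA → Fin n → Set
  Fixed O σ u = (σ u ≡ unacc → ⊥) ⊎ (∃ λ c → frozen O c σ ≡ true × u ∈ vbl (con c))

  update : PA → (u : Fin n) → PVal (qs u) → PA
  update σ u a v with v ≟ u
  ... | yes refl = a
  ... | no _     = σ v

-- Let σ u = ∘. Setting u to ⋆ leaves Λ(σ), hence every conditional probability, unchanged.
-- Setting u to a value b conditions on τ u = b. Coordinates are independent under the uniform
-- distribution, so this divides the number of σ-compatible assignments by q_u, and divides the
-- number violating c by q_u too when u ∉ vbl(c): then P[¬c | σ] is unchanged. When u ∈ vbl(c),
-- c is not frozen since u is not σ-fixed, so P[¬c | σ] ≤ p′, and conditioning raises it by at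
-- most the factor q_u ≤ q. Feasibility follows because P[¬c | σ_{u←b}] ≤ p′q ≤ 1/(4Δ+4) for all
-- c, and the counting form of the Lovász local lemma then yields a satisfying assignment
-- compatible with σ_{u←b}.

module Submission where

open import Defs
open import Data.Fin using (Fin)
open import Data.Product using (_×_)
open import Relation.Nullary using (¬_)
open import Relation.Binary.PropositionalEquality using (_≡_; _≢_)

import Algebra.Properties.CommutativeSemigroup as CommutativeSemigroupProperties
open import Algebra.Bundles using (CommutativeMonoid)
open import Data.Bool using (Bool; true; false; T; _∧_; not; if_then_else_)
open import Data.Bool.ListAction using (all)
open import Data.Bool.Properties using (∧-commutativeMonoid; T?; T-≡; T-∧; ∧-identityʳ; ∧-zeroʳ; ∧-comm; ∧-assoc)
open import Data.Empty using (⊥-elim)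
open import Data.Fin using (_≟_; fromℕ<) renaming (zero to fz; suc to fs)
open import Data.Fin.Subset using (_∩_; ∣_∣) renaming (_∈_ to _∈ₛ_; _∉_ to _∉ₛ_)
open import Data.Fin.Subset.Properties using (_∈?_; nonempty?; ∣⁅x⁆∣≡1; p⊆q⇒∣p∣≤∣q∣; x∈⁅y⁆⇒x≡y; x∈p∩q⁺)
open import Data.List using (List; []; _∷_; _++_; map; foldr; length; filter; filterᵇ; concatMap; allFin)
open import Data.List.Membership.Propositional using (_∈_)
open import Data.List.Membership.Propositional.Properties using (∈-allFin; ∈-filter⁺; ∈-filter⁻)
open import Data.List.Properties using (filter-notAll; filter-++; length-++; map-cong; map-tabulate; length-tabulate)
open import Data.List.Relation.Binary.Sublist.Propositional using (_⊆_; ⊆-refl; ⊆-trans)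
open import Data.List.Relation.Binary.Sublist.Propositional.Properties using (filter-⊆; filter⁺; length-mono-≤; ∷ˡ⁻)
open import Data.List.Relation.Unary.All as All using (All; []; _∷_)
open import Data.List.Relation.Unary.Any as Any using (here; there)
open import Data.Nat using (ℕ; zero; suc; _+_; _*_; _⊔_; _^_; _!; _≤_; _<_; z≤n; s≤s; NonZero; >-nonZero)
open import Data.Nat.Induction using (<-wellFounded)
open import Data.Nat.ListAction using (sum)
open import Data.Nat.Properties hiding (_≟_)
open import Data.Nat.Tactic.RingSolver using (solve-∀)
open import Data.Product using (∃; _,_; proj₁; proj₂)
open import Data.Sum using (_⊎_; inj₁; inj₂; swap)
open import Data.Unit using (tt)
open import Function using (_∘_; id; case_of_; Equivalence)
import Induction.WellFounded as WF
open import Relation.Binary.PropositionalEquality using (refl; sym; trans; cong; cong₂; subst; subst₂; module ≡-Reasoning)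
import Relation.Binary.Construct.On as On
open import Relation.Nullary using (does; yes; no)
open import Relation.Nullary.Decidable using (⌊_⌋; toWitness; fromWitness)
open import Relation.Unary using (U; Decidable; ∁)
open import Relation.Unary.Properties using (∁?)

module ∧ = CommutativeSemigroupProperties (CommutativeMonoid.commutativeSemigroup ∧-commutativeMonoid)


T-injective : ∀ {x y} → (T x → T y) → (T y → T x) → x ≡ y
T-injective {false} {false} _ _ = refl
T-injective {false} {true}  _ y⇒x = ⊥-elim (y⇒x _)
T-injective {true}  {false} x⇒y _ = ⊥-elim (x⇒y _)
T-injective {true}  {true}  _ _ = refl

T-∧⁻ : ∀ x {y} → T (x ∧ y) → T x × T y
T-∧⁻ x = Equivalence.to (T-∧ {x})

T-∧⁺ : ∀ {x y} → T x → T y → T (x ∧ y)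
T-∧⁺ tx ty = Equivalence.from T-∧ (tx , ty)

¬T-all : ∀ {A : Set} (p : A → Bool) xs → ¬ T (all p xs) → ∃ λ x → ¬ T (p x)
¬T-all p []       ¬t = ⊥-elim (¬t _)
¬T-all p (x ∷ xs) ¬t with p x in eq
... | true  = ¬T-all p xs ¬t
... | false = x , subst (¬_ ∘ T) (sym eq) (λ ())

T-all⇒All : ∀ {A : Set} (p : A → Bool) xs → T (all p xs) → All (T ∘ p) xs
T-all⇒All p []       _ = []
T-all⇒All p (x ∷ xs) t = let px , pxs = T-∧⁻ (p x) t in px ∷ T-all⇒All p xs pxs

countᵇ : {A : Set} → (A → Bool) → List A → ℕ
countᵇ p xs = length (filterᵇ p xs)

module _ {A : Set} where

  countᵇ-cong : ∀ {p p′ : A → Bool} xs → (∀ x → p x ≡ p′ x) → countᵇ p xs ≡ countᵇ p′ xs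
  countᵇ-cong []       p≗p′ = refl
  countᵇ-cong {p} {p′} (x ∷ xs) p≗p′ with p x | p′ x | p≗p′ x
  ... | true  | true  | refl = cong suc (countᵇ-cong xs p≗p′)
  ... | false | false | refl = countᵇ-cong xs p≗p′

  countᵇ-mono : ∀ {p p′ : A → Bool} xs → (∀ x → T (p x) → T (p′ x)) → countᵇ p xs ≤ countᵇ p′ xs
  countᵇ-mono []       p⇒p′ = z≤n
  countᵇ-mono {p} {p′} (x ∷ xs) p⇒p′ with p x | p′ x | p⇒p′ x
  ... | true  | true  | _ = s≤s (countᵇ-mono xs p⇒p′)
  ... | true  | false | f = ⊥-elim (f _)
  ... | false | true  | _ = m≤n⇒m≤1+n (countᵇ-mono xs p⇒p′)
  ... | false | false | _ = countᵇ-mono xs p⇒p′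

  countᵇ-split : ∀ (p q : A → Bool) xs →
                 countᵇ p xs ≡ countᵇ (λ x → p x ∧ q x) xs + countᵇ (λ x → p x ∧ not (q x)) xs
  countᵇ-split p q [] = refl
  countᵇ-split p q (x ∷ xs) with p x | q x
  ... | true  | true  = cong suc (countᵇ-split p q xs)
  ... | true  | false = trans (cong suc (countᵇ-split p q xs)) (sym (+-suc _ _))
  ... | false | _     = countᵇ-split p q xs

  countᵇ-witness : ∀ (p : A → Bool) xs → 0 < countᵇ p xs → ∃ λ x → T (p x)
  countᵇ-witness p (x ∷ xs) pos with p x in eq
  ... | true  = x , subst T (sym eq) _
  ... | false = countᵇ-witness p xs pos

  countᵇ-concatMap : ∀ {B : Set} (p : A → Bool) (F : B → List A) ys →
                     countᵇ p (concatMap F ys) ≡ sum (map (countᵇ p ∘ F) ys)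
  countᵇ-concatMap p F [] = refl
  countᵇ-concatMap p F (y ∷ ys) = begin
    length (filterᵇ p (F y ++ concatMap F ys))          ≡⟨ cong length (filter-++ (T? ∘ p) (F y) (concatMap F ys)) ⟩
    length (filterᵇ p (F y) ++ filterᵇ p (concatMap F ys)) ≡⟨ length-++ (filterᵇ p (F y)) ⟩
    countᵇ p (F y) + countᵇ p (concatMap F ys)            ≡⟨ cong (countᵇ p (F y) +_) (countᵇ-concatMap p F ys) ⟩
    sum (map (countᵇ p ∘ F) (y ∷ ys))                     ∎
    where open ≡-Reasoning

  countᵇ-map : ∀ {B : Set} (p : A → Bool) (f : B → A) ys → countᵇ p (map f ys) ≡ countᵇ (p ∘ f) ys
  countᵇ-map p f [] = refl
  countᵇ-map p f (y ∷ ys) with p (f y)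
  ... | true  = cong suc (countᵇ-map p f ys)
  ... | false = countᵇ-map p f ys

  countᵇ-const : ∀ b (xs : List A) → countᵇ (λ _ → b) xs ≡ (if b then length xs else 0)
  countᵇ-const true  []       = refl
  countᵇ-const true  (x ∷ xs) = cong suc (countᵇ-const true xs)
  countᵇ-const false []       = refl
  countᵇ-const false (x ∷ xs) = countᵇ-const false xs

module _ {A : Set} where

  ∈⇒length-pos : ∀ {x : A} {xs} → x ∈ xs → 0 < length xs
  ∈⇒length-pos (here _)  = s≤s z≤n
  ∈⇒length-pos (there _) = s≤s z≤n

  sum-map-cong : ∀ {f g : A → ℕ} xs → (∀ x → f x ≡ g x) → sum (map f xs) ≡ sum (map g xs)
  sum-map-cong xs f≗g = cong sum (map-cong f≗g xs)

  sum-map-const : ∀ k (xs : List A) → sum (map (λ _ → k) xs) ≡ length xs * k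
  sum-map-const k []       = refl
  sum-map-const k (x ∷ xs) = cong (k +_) (sum-map-const k xs)

  sum-map-*ʳ : ∀ (f : A → ℕ) k xs → sum (map f xs) * k ≡ sum (map (λ x → f x * k) xs)
  sum-map-*ʳ f k []       = refl
  sum-map-*ʳ f k (x ∷ xs) = trans (*-distribʳ-+ k (f x) _) (cong (f x * k +_) (sum-map-*ʳ f k xs))

  sum-map-if : ∀ (p : A → Bool) k xs → sum (map (λ x → if p x then k else 0) xs) ≡ countᵇ p xs * k
  sum-map-if p k [] = refl
  sum-map-if p k (x ∷ xs) with p x
  ... | true  = cong (k +_) (sum-map-if p k xs)
  ... | false = sum-map-if p k xs

  sum-map-≥ : ∀ (f : A → ℕ) {x xs} → x ∈ xs → f x ≤ sum (map f xs)
  sum-map-≥ f {xs = y ∷ xs} (here refl) = m≤m+n (f y) _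
  sum-map-≥ f {xs = y ∷ xs} (there x∈)  = ≤-trans (sum-map-≥ f x∈) (m≤n+m _ (f y))

  ≤-foldr-⊔ : ∀ (f : A → ℕ) {x xs} → x ∈ xs → f x ≤ foldr _⊔_ 0 (map f xs)
  ≤-foldr-⊔ f {xs = y ∷ xs} (here refl) = m≤m⊔n (f y) _
  ≤-foldr-⊔ f {xs = y ∷ xs} (there x∈)  = ≤-trans (≤-foldr-⊔ f x∈) (m≤n⊔m (f y) _)

  sum-map-*-≤ : ∀ (f : A → ℕ) {d k} xs → (∀ x → x ∈ xs → f x * d ≤ k) → sum (map f xs) * d ≤ length xs * k
  sum-map-*-≤ f []       bound = z≤n
  sum-map-*-≤ f {d} (x ∷ xs) bound = begin
    (f x + sum (map f xs)) * d    ≡⟨ *-distribʳ-+ d (f x) _ ⟩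
    f x * d + sum (map f xs) * d  ≤⟨ +-mono-≤ (bound x (here refl)) (sum-map-*-≤ f xs (λ y y∈ → bound y (there y∈))) ⟩
    _ + length xs * _             ∎
    where open ≤-Reasoning

  sum-map-*-const : ∀ (f g : A → ℕ) xs → (∀ x y → f x ≡ f y) →
                    sum (map (λ x → f x * g x) xs) * length xs ≡ sum (map f xs) * sum (map g xs)
  sum-map-*-const f g []       f-const = refl
  sum-map-*-const f g (x ∷ xs) f-const = begin
    sum (map (λ y → f y * g y) (x ∷ xs)) * ℓ ≡⟨ cong (_* ℓ) (sum-map-cong (x ∷ xs) (λ y → cong (_* g y) (f-const y x))) ⟩
    sum (map (λ y → f x * g y) (x ∷ xs)) * ℓ ≡⟨ cong (_* ℓ) (sym (sum-map-*ˡ g (f x) (x ∷ xs))) ⟩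
    f x * sum (map g (x ∷ xs)) * ℓ           ≡⟨ *-comm-middle (f x) _ ℓ ⟩
    ℓ * f x * sum (map g (x ∷ xs))           ≡⟨ cong (_* sum (map g (x ∷ xs))) (sym (sum-map-const (f x) (x ∷ xs))) ⟩
    sum (map (λ _ → f x) (x ∷ xs)) * sum (map g (x ∷ xs))
      ≡⟨ cong (_* sum (map g (x ∷ xs))) (sum-map-cong (x ∷ xs) (f-const x)) ⟩
    sum (map f (x ∷ xs)) * sum (map g (x ∷ xs)) ∎
    where
    open ≡-Reasoning
    ℓ = length (x ∷ xs)
    *-comm-middle : ∀ a b c → a * b * c ≡ c * a * b
    *-comm-middle = solve-∀
    sum-map-*ˡ : ∀ (h : A → ℕ) k ys → k * sum (map h ys) ≡ sum (map (λ y → k * h y) ys)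
    sum-map-*ˡ h k ys = trans (*-comm k _) (trans (sum-map-*ʳ h k ys) (sum-map-cong ys (λ y → *-comm (h y) k)))

-- Counting assignments

count : ∀ {n qs} → (Assign n qs → Bool) → ℕ
count {n} {qs} f = countᵇ f (allAssign n qs)

DependsOnly : ∀ {n qs} → (Fin n → Set) → (Assign n qs → Bool) → Set
DependsOnly {n} {qs} A f = ∀ (τ τ′ : Assign n qs) → (∀ w → A w → τ w ≡ τ′ w) → f τ ≡ f τ′

DependsOnly-mono : ∀ {n qs} {A B : Fin n → Set} {f : Assign n qs → Bool} →
                   (∀ w → A w → B w) → DependsOnly A f → DependsOnly B f
DependsOnly-mono A⊆B f-loc τ τ′ τ≈τ′ = f-loc τ τ′ (λ w → τ≈τ′ w ∘ A⊆B w)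

DependsOnly-∧ : ∀ {n qs} {A : Fin n → Set} {f g : Assign n qs → Bool} →
                DependsOnly A f → DependsOnly A g → DependsOnly A (λ τ → f τ ∧ g τ)
DependsOnly-∧ f-loc g-loc τ τ′ τ≈τ′ = cong₂ _∧_ (f-loc τ τ′ τ≈τ′) (g-loc τ τ′ τ≈τ′)

DependsOnly⇒Extensional : ∀ {n qs} {A : Fin n → Set} {f : Assign n qs → Bool} → DependsOnly A f → DependsOnly U f
DependsOnly⇒Extensional = DependsOnly-mono (λ _ _ → tt)

count-cong : ∀ {n qs} {f g : Assign n qs → Bool} → (∀ τ → f τ ≡ g τ) → count f ≡ count g
count-cong {n} {qs} = countᵇ-cong (allAssign n qs)

count-mono : ∀ {n qs} {f g : Assign n qs → Bool} → (∀ τ → T (f τ) → T (g τ)) → count f ≤ count g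
count-mono {n} {qs} = countᵇ-mono (allAssign n qs)

extend : ∀ {n} {qs : Fin (suc n) → ℕ} → Fin (qs fz) → Assign n (qs ∘ fs) → Assign (suc n) qs
extend a τ fz     = a
extend a τ (fs w) = τ w

-- Assignments are functions and there is no function extensionality, so f must be assumed
-- to respect pointwise equality to be transported along the enumeration in allAssign.
count-suc : ∀ {n qs} (f : Assign (suc n) qs → Bool) → DependsOnly U f →
            count f ≡ sum (map (λ a → count (f ∘ extend a)) (allFin (qs fz)))
count-suc {n} {qs} f f-ext =
  trans (countᵇ-concatMap f _ (allFin (qs fz)))
        (sum-map-cong (allFin (qs fz)) λ a →
          trans (countᵇ-map f _ (allAssign n (qs ∘ fs)))
                (countᵇ-cong (allAssign n (qs ∘ fs)) λ τ → f-ext _ _ λ { fz _ → refl ; (fs w) _ → refl }))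

DependsOnly-extend : ∀ {n qs} {A : Fin (suc n) → Set} {f : Assign (suc n) qs → Bool} (a : Fin (qs fz)) →
                     DependsOnly A f → DependsOnly (A ∘ fs) (f ∘ extend a)
DependsOnly-extend a f-loc τ τ′ τ≈τ′ = f-loc _ _ λ { fz _ → refl ; (fs w) → τ≈τ′ w }

count-extend-irrelevant : ∀ {n qs} {A : Fin (suc n) → Set} {f : Assign (suc n) qs → Bool} →
                          ¬ A fz → DependsOnly A f → ∀ a b → count (f ∘ extend a) ≡ count (f ∘ extend b)
count-extend-irrelevant {n} {qs} ¬Afz f-loc a b =
  count-cong {n} {qs ∘ fs} λ τ → f-loc _ _ λ { fz Afz → ⊥-elim (¬Afz Afz) ; (fs w) _ → refl }

ProductRule : ℕ → Set₁
ProductRule n = ∀ {qs} {A B : Fin n → Set} → (∀ w → ¬ A w ⊎ ¬ B w) →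
                ∀ {f g : Assign n qs → Bool} → DependsOnly A f → DependsOnly B g →
                count (λ τ → f τ ∧ g τ) * count {n} {qs} (λ _ → true) ≡ count f * count g

product-rule-zero : ProductRule zero
product-rule-zero _ {f} {g} _ _ = singleton _
  where
  singleton : ∀ τ → countᵇ (λ τ → f τ ∧ g τ) (τ ∷ []) * countᵇ (λ _ → true) (τ ∷ []) ≡
                    countᵇ f (τ ∷ []) * countᵇ g (τ ∷ [])
  singleton τ with f τ | g τ
  ... | true  | true  = refl
  ... | true  | false = refl
  ... | false | _     = refl

product-rule-suc : ∀ {n} → ProductRule n → ∀ {qs} {A B : Fin (suc n) → Set} → ¬ A fz →
                   ∀ {f g : Assign (suc n) qs → Bool} → DependsOnly A f → DependsOnly B g →
                   (∀ w → ¬ A (fs w) ⊎ ¬ B (fs w)) →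
                   count (λ τ → f τ ∧ g τ) * count {suc n} {qs} (λ _ → true) ≡ count f * count g
product-rule-suc {n} IH {qs} ¬Afz {f} {g} f-loc g-loc disj = begin
  count (λ τ → f τ ∧ g τ) * count {suc n} {qs} (λ _ → true)
    ≡⟨ cong₂ _*_ (count-suc _ (DependsOnly-∧ (DependsOnly⇒Extensional f-loc) (DependsOnly⇒Extensional g-loc)))
                 (count-suc {n} {qs} _ (λ _ _ _ → refl)) ⟩
  sum (map H as) * sum (map (λ _ → N) as)    ≡⟨ cong (sum (map H as) *_) (sum-map-const N as) ⟩
  sum (map H as) * (length as * N)           ≡⟨ *-comm-middle (sum (map H as)) (length as) N ⟩
  sum (map H as) * N * length as             ≡⟨ cong (_* length as) (sum-map-*ʳ H N as) ⟩
  sum (map (λ a → H a * N) as) * length as   ≡⟨ cong (_* length as) (sum-map-cong as λ a →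
                                                   IH disj (DependsOnly-extend a f-loc) (DependsOnly-extend a g-loc)) ⟩
  sum (map (λ a → F a * G a) as) * length as ≡⟨ sum-map-*-const F G as (count-extend-irrelevant ¬Afz f-loc) ⟩
  sum (map F as) * sum (map G as)
    ≡⟨ sym (cong₂ _*_ (count-suc f (DependsOnly⇒Extensional f-loc)) (count-suc g (DependsOnly⇒Extensional g-loc))) ⟩
  count f * count g                          ∎
  where
  open ≡-Reasoning
  as = allFin (qs fz)
  N = count {n} {qs ∘ fs} (λ _ → true)
  F G H : Fin (qs fz) → ℕ
  F a = count (f ∘ extend a)
  G a = count (g ∘ extend a)
  H a = count (λ τ → f (extend a τ) ∧ g (extend a τ))
  *-comm-middle : ∀ x y z → x * (y * z) ≡ x * z * y
  *-comm-middle = solve-∀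

product-rule : ∀ n → ProductRule n
product-rule zero = product-rule-zero
product-rule (suc n) {qs} disj {f} {g} f-loc g-loc with disj fz
... | inj₁ ¬Afz = product-rule-suc (product-rule n) ¬Afz f-loc g-loc (disj ∘ fs)
... | inj₂ ¬Bfz = begin
  count (λ τ → f τ ∧ g τ) * count {suc n} {qs} (λ _ → true) ≡⟨ cong (_* _) (count-cong λ τ → ∧-comm (f τ) (g τ)) ⟩
  count (λ τ → g τ ∧ f τ) * count {suc n} {qs} (λ _ → true) ≡⟨ product-rule-suc (product-rule n) ¬Bfz g-loc f-loc (swap ∘ disj ∘ fs) ⟩
  count g * count f                             ≡⟨ *-comm (count g) (count f) ⟩
  count f * count g                             ∎
  where open ≡-Reasoning

countᵇ-≟-allFin : ∀ {k} (b : Fin k) → countᵇ (λ a → ⌊ a ≟ b ⌋) (allFin k) ≡ 1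
countᵇ-≟-allFin {suc k} b = trans (cong (λ xs → countᵇ (λ a → ⌊ a ≟ b ⌋) (fz ∷ xs)) (sym (map-tabulate id fs)))
                                  (rest b)
  where
  ≟-fs : ∀ (a b′ : Fin k) → ⌊ fs a ≟ fs b′ ⌋ ≡ ⌊ a ≟ b′ ⌋
  ≟-fs a b′ with a ≟ b′
  ... | yes _ = refl
  ... | no  _ = refl
  rest : ∀ b → countᵇ (λ a → ⌊ a ≟ b ⌋) (fz ∷ map fs (allFin k)) ≡ 1
  rest fz      = cong suc (trans (countᵇ-map _ fs (allFin k)) (countᵇ-const false (allFin k)))
  rest (fs b′) = trans (countᵇ-map _ fs (allFin k)) (trans (countᵇ-cong (allFin k) (λ a → ≟-fs a b′)) (countᵇ-≟-allFin b′))

count-∧-const : ∀ {n qs} (f : Assign n qs → Bool) b → count (λ τ → f τ ∧ b) ≡ (if b then count f else 0)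
count-∧-const {n} {qs} f true  = count-cong (λ τ → ∧-identityʳ (f τ))
count-∧-const {n} {qs} f false = trans (count-cong (λ τ → ∧-zeroʳ (f τ))) (countᵇ-const false (allAssign n qs))

count-pos : ∀ {n qs} {f : Assign n qs → Bool} → DependsOnly U f → (τ : Assign n qs) → T (f τ) → 0 < count f
count-pos {zero} {qs} {f} f-ext τ fτ = singleton _ (f-ext τ _ λ ())
  where
  singleton : ∀ τ′ → f τ ≡ f τ′ → 0 < countᵇ f (τ′ ∷ [])
  singleton τ′ fτ≡fτ′ with f τ′
  ... | true  = s≤s z≤n
  ... | false = ⊥-elim (subst T fτ≡fτ′ fτ)
count-pos {suc n} {qs} {f} f-ext τ fτ = begin-strict
  0                         <⟨ count-pos {n} {qs ∘ fs} {f ∘ extend (τ fz)} (DependsOnly-extend (τ fz) f-ext) (τ ∘ fs) fτ′ ⟩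
  count (f ∘ extend (τ fz)) ≤⟨ sum-map-≥ (λ a → count (f ∘ extend a)) (∈-allFin (τ fz)) ⟩
  sum (map (λ a → count (f ∘ extend a)) (allFin (qs fz))) ≡⟨ sym (count-suc f f-ext) ⟩
  count f                   ∎
  where
  open ≤-Reasoning
  fτ′ : T (f (extend (τ fz) (τ ∘ fs)))
  fτ′ = subst T (f-ext τ _ λ { fz _ → refl ; (fs w) _ → refl }) fτ

≟-extensional : ∀ {n qs} (u : Fin n) (b : Fin (qs u)) → DependsOnly {n} {qs} U (λ τ → ⌊ τ u ≟ b ⌋)
≟-extensional u b _ _ τ≈τ′ = cong (λ x → ⌊ x ≟ b ⌋) (τ≈τ′ u _)

count-fix-coordinate : ∀ {n qs} (u : Fin n) (b : Fin (qs u)) {f : Assign n qs → Bool} → DependsOnly (_≢ u) f →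
            count (λ τ → f τ ∧ ⌊ τ u ≟ b ⌋) * qs u ≡ count f
count-fix-coordinate {suc n} {qs} fz b {f} f-loc = begin
  count (λ τ → f τ ∧ ⌊ τ fz ≟ b ⌋) * qs fz
    ≡⟨ cong (_* qs fz) (count-suc _ (DependsOnly-∧ (DependsOnly⇒Extensional f-loc) (≟-extensional {qs = qs} fz b))) ⟩
  sum (map (λ a → count (λ τ → f (extend a τ) ∧ ⌊ a ≟ b ⌋)) as) * qs fz
    ≡⟨ cong (_* qs fz) (sum-map-cong as λ a → trans (count-∧-const (f ∘ extend a) ⌊ a ≟ b ⌋)
                                                      (cong (if ⌊ a ≟ b ⌋ then_else 0) (C≡ a b))) ⟩
  sum (map (λ a → if ⌊ a ≟ b ⌋ then C b else 0) as) * qs fz   ≡⟨ cong (_* qs fz) (sum-map-if _ (C b) as) ⟩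
  countᵇ (λ a → ⌊ a ≟ b ⌋) as * C b * qs fz                    ≡⟨ cong (λ k → k * C b * qs fz) (countᵇ-≟-allFin b) ⟩
  1 * C b * qs fz                                              ≡⟨ trans (cong (_* qs fz) (*-identityˡ (C b))) (*-comm (C b) (qs fz)) ⟩
  qs fz * C b                                                  ≡⟨ cong (_* C b) (sym (length-tabulate {n = qs fz} id)) ⟩
  length as * C b                                              ≡⟨ sym (sum-map-const (C b) as) ⟩
  sum (map (λ _ → C b) as)                                     ≡⟨ sum-map-cong as (λ a → C≡ b a) ⟩
  sum (map C as)                                               ≡⟨ sym (count-suc f (DependsOnly⇒Extensional f-loc)) ⟩
  count f                                                      ∎
  where
  open ≡-Reasoning
  as = allFin (qs fz)
  C : Fin (qs fz) → ℕ
  C a = count (f ∘ extend a)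
  C≡ : ∀ a a′ → C a ≡ C a′
  C≡ = count-extend-irrelevant (λ fz≢fz → fz≢fz refl) f-loc
count-fix-coordinate {suc n} {qs} (fs u) b {f} f-loc = begin
  count (λ τ → f τ ∧ ⌊ τ (fs u) ≟ b ⌋) * qs (fs u)
    ≡⟨ cong (_* qs (fs u)) (count-suc _ (DependsOnly-∧ (DependsOnly⇒Extensional f-loc) (≟-extensional {qs = qs} (fs u) b))) ⟩
  sum (map (λ a → count (λ τ → f (extend a τ) ∧ ⌊ τ u ≟ b ⌋)) as) * qs (fs u)
    ≡⟨ sum-map-*ʳ _ (qs (fs u)) as ⟩
  sum (map (λ a → count (λ τ → f (extend a τ) ∧ ⌊ τ u ≟ b ⌋) * qs (fs u)) as)
    ≡⟨ sum-map-cong as (λ a → count-fix-coordinate u b (DependsOnly-mono (λ w fsw≢fsu w≡u → fsw≢fsu (cong fs w≡u))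
                                                              (DependsOnly-extend a f-loc))) ⟩
  sum (map (λ a → count (f ∘ extend a)) as)
    ≡⟨ sym (count-suc f (DependsOnly⇒Extensional f-loc)) ⟩
  count f ∎
  where
  open ≡-Reasoning
  as = allFin (qs fz)

·e²≤-mono : ∀ {A A′ B B′} → A′ ≤ A → B ≤ B′ → A ·e²≤ B → A′ ·e²≤ B′
·e²≤-mono A′≤A B≤B′ A≤B j = ≤-trans (*-monoˡ-≤ _ A′≤A) (≤-trans (A≤B j) (*-monoˡ-≤ _ B≤B′))

·e²≤-cancelʳ : ∀ {A B} N .{{_ : NonZero N}} → (A * N) ·e²≤ (B * N) → A ·e²≤ B
·e²≤-cancelʳ {A} {B} N AN≤BN j = *-cancelʳ-≤ _ _ N (begin
  A * S j ^ 2 * N     ≡⟨ *-swapʳ A (S j ^ 2) N ⟩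
  A * N * S j ^ 2     ≤⟨ AN≤BN j ⟩
  B * N * (j !) ^ 2   ≡⟨ *-swapʳ B N ((j !) ^ 2) ⟩
  B * (j !) ^ 2 * N   ∎)
  where
  open ≤-Reasoning
  *-swapʳ : ∀ x y z → x * y * z ≡ x * z * y
  *-swapʳ = solve-∀

≯·e²⇒·e²≤ : ∀ {A B} → ¬ (A ·e²> B) → A ·e²≤ B
≯·e²⇒·e²≤ A≯B j = ≮⇒≥ (λ lt → A≯B (j , lt))

-- At j = 1 the lower partial sum of e is S 1 / 1! = 2.
·e²≤⇒*4≤ : ∀ {A B} → A ·e²≤ B → A * 4 ≤ B
·e²≤⇒*4≤ {A} {B} A≤B = subst (A * 4 ≤_) (*-identityʳ B) (A≤B 1)

4Δ+4≤K : ∀ q k Δ → 1 ≤ q → 1 ≤ k → 1 ≤ Δ → (4 * Δ + 4) * q ≤ 18 * (q ^ 2) * k * (Δ ^ 4) * 4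
4Δ+4≤K q@(suc _) k@(suc _) Δ@(suc _) _ _ _ = begin
  (4 * Δ + 4) * q                    ≤⟨ *-monoˡ-≤ q (+-monoʳ-≤ (4 * Δ) (*-monoʳ-≤ 4 (s≤s z≤n))) ⟩
  (4 * Δ + 4 * Δ) * q                ≤⟨ m≤m*n ((4 * Δ + 4 * Δ) * q) (9 * q * k * Δ ^ 3) ⟩
  (4 * Δ + 4 * Δ) * q * (9 * q * k * Δ ^ 3) ≡⟨ reassociate q k Δ ⟩
  18 * (q ^ 2) * k * (Δ ^ 4) * 4     ∎
  where
  open ≤-Reasoning
  reassociate : ∀ q k Δ → (4 * Δ + 4 * Δ) * q * (9 * q * k * (Δ * (Δ * (Δ * 1)))) ≡
                          18 * (q * (q * 1)) * k * (Δ * (Δ * (Δ * (Δ * 1)))) * 4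
  reassociate = solve-∀

union-arith : ∀ {X Y Σ} Δ → X ≤ Y + Σ → Σ * (4 * Δ + 4) ≤ Δ * (2 * X) → X ≤ 2 * Y
union-arith {X} {Y} {Σ} Δ X≤Y+Σ ΣD≤2ΔX = *-cancelʳ-≤ X (2 * Y) (2 + 2 * Δ) (begin
  X * (2 + 2 * Δ)        ≤⟨ *-monoʳ-≤ X (+-monoˡ-≤ (2 * Δ) {2} {4} (s≤s (s≤s z≤n))) ⟩
  X * (4 + 2 * Δ)        ≤⟨ +-cancelʳ-≤ (Δ * (2 * X)) _ _ (begin
     X * (4 + 2 * Δ) + Δ * (2 * X) ≡⟨ split-D X Δ ⟩
     X * (4 * Δ + 4)               ≤⟨ *-monoˡ-≤ (4 * Δ + 4) X≤Y+Σ ⟩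
     (Y + Σ) * (4 * Δ + 4)         ≡⟨ *-distribʳ-+ (4 * Δ + 4) Y Σ ⟩
     Y * (4 * Δ + 4) + Σ * (4 * Δ + 4) ≤⟨ +-monoʳ-≤ (Y * (4 * Δ + 4)) ΣD≤2ΔX ⟩
     Y * (4 * Δ + 4) + Δ * (2 * X) ∎) ⟩
  Y * (4 * Δ + 4)        ≡⟨ double Y Δ ⟩
  2 * Y * (2 + 2 * Δ)    ∎)
  where
  open ≤-Reasoning
  split-D : ∀ X Δ → X * (4 + 2 * Δ) + Δ * (2 * X) ≡ X * (4 * Δ + 4)
  split-D = solve-∀
  double : ∀ Y Δ → Y * (4 * Δ + 4) ≡ 2 * Y * (2 + 2 * Δ)
  double = solve-∀

0<m*n⇒0<m : ∀ m {n} → 0 < m * n → 0 < m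
0<m*n⇒0<m (suc _) _ = s≤s z≤n

positivity-arith : ∀ {W Z} Δ → 0 < W + Z → Z * (4 * Δ + 4) ≤ 2 * (W + Z) → 0 < W
positivity-arith {suc W} Δ _ _ = s≤s z≤n
positivity-arith {zero} {Z} Δ 0<Z ZD≤2Z = ⊥-elim (<-irrefl refl (begin-strict
  2 * Z            <⟨ *-monoˡ-< Z {{>-nonZero 0<Z}} {2} {4} (s≤s (s≤s (s≤s z≤n))) ⟩
  4 * Z            ≤⟨ m≤n+m (4 * Z) (4 * Δ * Z) ⟩
  4 * Δ * Z + 4 * Z ≡⟨ factor Z Δ ⟩
  Z * (4 * Δ + 4)  ≤⟨ ZD≤2Z ⟩
  2 * Z            ∎))
  where
  open ≤-Reasoning
  factor : ∀ Z Δ → 4 * Δ * Z + 4 * Z ≡ Z * (4 * Δ + 4)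
  factor = solve-∀

≡unacc-stable : ∀ {k} (x : PVal k) → ¬ ¬ x ≡ unacc → x ≡ unacc
≡unacc-stable (val _) ¬¬x≡∘ = ⊥-elim (¬¬x≡∘ λ ())
≡unacc-stable star    ¬¬x≡∘ = ⊥-elim (¬¬x≡∘ λ ())
≡unacc-stable unacc   _     = refl

module _ (Φ : CSP) where
  open CSP Φ
  open Constraint

  Assigned : PA Φ → Fin n → Set
  Assigned σ w = ∃ λ a → σ w ≡ val a

  agreesᵇ-sound : ∀ {σ τ} → T (agreesᵇ Φ σ τ) → Agrees Φ σ τ
  agreesᵇ-sound {σ} {τ} t v a σv≡a with σ v | All.lookup (T-all⇒All _ (allFin n) t) (∈-allFin v)
  agreesᵇ-sound t v a refl | .(val a) | ok = sym (toWitness ok)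

  agreesᵇ-complete : ∀ {σ τ} → Agrees Φ σ τ → T (agreesᵇ Φ σ τ)
  agreesᵇ-complete {σ} {τ} ag with T? (agreesᵇ Φ σ τ)
  ... | yes t = t
  ... | no ¬t with ¬T-all _ (allFin n) ¬t
  ... | v , ¬ok with σ v | ag v
  ... | val a | agv = ⊥-elim (¬ok (fromWitness (sym (agv a refl))))
  ... | star  | _   = ⊥-elim (¬ok _)
  ... | unacc | _   = ⊥-elim (¬ok _)

  agreesᵇ-cong : ∀ {σ σ′ τ τ′} → (Agrees Φ σ τ → Agrees Φ σ′ τ′) → (Agrees Φ σ′ τ′ → Agrees Φ σ τ) →
                 agreesᵇ Φ σ τ ≡ agreesᵇ Φ σ′ τ′
  agreesᵇ-cong to from = T-injective (agreesᵇ-complete ∘ to ∘ agreesᵇ-sound) (agreesᵇ-complete ∘ from ∘ agreesᵇ-sound)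

  agreesᵇ-local : ∀ σ → DependsOnly (Assigned σ) (agreesᵇ Φ σ)
  agreesᵇ-local σ τ τ′ τ≈τ′ = agreesᵇ-cong (transfer τ≈τ′) (transfer λ w a → sym (τ≈τ′ w a))
    where
    transfer : ∀ {τ τ′} → (∀ w → Assigned σ w → τ w ≡ τ′ w) → Agrees Φ σ τ → Agrees Φ σ τ′
    transfer τ≈τ′ ag w a σw≡a = trans (sym (τ≈τ′ w (a , σw≡a))) (ag w a σw≡a)

  restrict : PA Φ → {P : Fin n → Set} → Decidable P → PA Φ
  restrict σ P? w = if does (P? w) then σ w else unacc

  Assigned-restrict : ∀ σ {P : Fin n → Set} (P? : Decidable P) w → Assigned (restrict σ P?) w → P w
  Assigned-restrict σ P? w (a , eq) with P? w
  ... | yes Pw = Pw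
  Assigned-restrict σ P? w (a , ()) | no _

  Agrees-restrict : ∀ σ τ {P : Fin n → Set} (P? : Decidable P) →
                    Agrees Φ (restrict σ P?) τ → Agrees Φ (restrict σ (∁? P?)) τ → Agrees Φ σ τ
  Agrees-restrict σ τ P? ag ag∁ w a σw≡a with P? w | ag w a | ag∁ w a
  ... | yes _ | agw | _    = agw σw≡a
  ... | no  _ | _   | ag∁w = ag∁w σw≡a

  Agrees-restrict⁻ : ∀ σ τ {P : Fin n → Set} (P? : Decidable P) → Agrees Φ σ τ → Agrees Φ (restrict σ P?) τ
  Agrees-restrict⁻ σ τ P? ag w a with P? w
  ... | yes _ = ag w a
  ... | no  _ = λ ()

  agreesᵇ-restrict : ∀ σ τ {P : Fin n → Set} (P? : Decidable P) →
                     agreesᵇ Φ σ τ ≡ agreesᵇ Φ (restrict σ P?) τ ∧ agreesᵇ Φ (restrict σ (∁? P?)) τ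
  agreesᵇ-restrict σ τ P? = T-injective
    (λ t → let ag = agreesᵇ-sound t in
           T-∧⁺ (agreesᵇ-complete (Agrees-restrict⁻ σ τ P? ag)) (agreesᵇ-complete (Agrees-restrict⁻ σ τ (∁? P?) ag)))
    (λ t → let t₁ , t₂ = T-∧⁻ _ t in
           agreesᵇ-complete (Agrees-restrict σ τ P? (agreesᵇ-sound t₁) (agreesᵇ-sound t₂)))

  update-≡ : ∀ σ u (a : PVal (qs u)) → update Φ σ u a u ≡ a
  update-≡ σ u a with u ≟ u
  ... | yes refl = refl
  ... | no  u≢u  = ⊥-elim (u≢u refl)

  update-≢ : ∀ σ u (a : PVal (qs u)) {w} → w ≢ u → update Φ σ u a w ≡ σ w
  update-≢ σ u a {w} w≢u with w ≟ u
  ... | yes w≡u = ⊥-elim (w≢u w≡u)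
  ... | no  _   = refl

  Assigned⇒≢ : ∀ {σ u w} → σ u ≡ unacc → Assigned σ w → w ≢ u
  Assigned⇒≢ σu≡∘ (a , σw≡a) refl = case trans (sym σu≡∘) σw≡a of λ ()

  agreesᵇ-update-val : ∀ {σ u} → σ u ≡ unacc → ∀ b τ →
                       agreesᵇ Φ (update Φ σ u (val b)) τ ≡ agreesᵇ Φ σ τ ∧ ⌊ τ u ≟ b ⌋
  agreesᵇ-update-val {σ} {u} σu≡∘ b τ = T-injective
    (λ t → let ag = agreesᵇ-sound t in
           T-∧⁺ (agreesᵇ-complete λ w a σw≡a → ag w a (trans (update-≢ σ u _ (Assigned⇒≢ σu≡∘ (a , σw≡a))) σw≡a))
                (fromWitness (ag u b (update-≡ σ u _))))
    (λ t → let t₁ , t₂ = T-∧⁻ (agreesᵇ Φ σ τ) t in agreesᵇ-complete (from (agreesᵇ-sound t₁) (toWitness t₂)))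
    where
    from : Agrees Φ σ τ → τ u ≡ b → Agrees Φ (update Φ σ u (val b)) τ
    from ag τu≡b w a eq with w ≟ u
    ... | yes refl = case eq of λ { refl → τu≡b }
    ... | no  w≢u  = ag w a eq

  agreesᵇ-update-star : ∀ {σ u} → σ u ≡ unacc → ∀ τ → agreesᵇ Φ (update Φ σ u star) τ ≡ agreesᵇ Φ σ τ
  agreesᵇ-update-star {σ} {u} σu≡∘ τ = agreesᵇ-cong
    (λ ag w a σw≡a → ag w a (trans (update-≢ σ u star (Assigned⇒≢ σu≡∘ (a , σw≡a))) σw≡a))
    (λ ag w a σ′w≡a → ag w a (trans (sym (update-≢ σ u star (w≢u σ′w≡a))) σ′w≡a))
    where
    w≢u : ∀ {w a} → update Φ σ u star w ≡ val a → w ≢ u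
    w≢u {w} eq refl = case trans (sym (update-≡ σ u star)) eq of λ ()

  violated : Fin m → Assign n qs → Bool
  violated c τ = not (check (con c) τ)

  violated-local : ∀ c → DependsOnly (_∈ₛ vbl (con c)) (violated c)
  violated-local c τ τ′ = cong not ∘ local (con c) τ τ′

  -- countGiven σ f / total Φ σ is P[f | σ].
  countGiven : PA Φ → (Assign n qs → Bool) → ℕ
  countGiven σ f = count (λ τ → agreesᵇ Φ σ τ ∧ f τ)

  countGiven-cong : ∀ σ {f g : Assign n qs → Bool} → (∀ τ → f τ ≡ g τ) → countGiven σ f ≡ countGiven σ g
  countGiven-cong σ f≗g = count-cong λ τ → cong (agreesᵇ Φ σ τ ∧_) (f≗g τ)

  countGiven-mono : ∀ σ {f g : Assign n qs → Bool} → (∀ τ → T (f τ) → T (g τ)) → countGiven σ f ≤ countGiven σ g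
  countGiven-mono σ {f} f⇒g = count-mono λ τ t →
    let ag , fτ = T-∧⁻ (agreesᵇ Φ σ τ) t in T-∧⁺ ag (f⇒g τ fτ)

  countGiven-split : ∀ σ (f g : Assign n qs → Bool) →
                     countGiven σ f ≡ countGiven σ (λ τ → f τ ∧ g τ) + countGiven σ (λ τ → f τ ∧ not (g τ))
  countGiven-split σ f g = trans (countᵇ-split _ g (allAssign n qs))
    (cong₂ _+_ (count-cong λ τ → ∧-assoc (agreesᵇ Φ σ τ) (f τ) (g τ))
               (count-cong λ τ → ∧-assoc (agreesᵇ Φ σ τ) (f τ) (not (g τ))))

  total≡countGiven : ∀ σ → total Φ σ ≡ countGiven σ (λ _ → true)
  total≡countGiven σ = count-cong {f = agreesᵇ Φ σ} (λ τ → sym (∧-identityʳ _))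

  count-all-pos : 0 < count {n} {qs} (λ _ → true)
  count-all-pos = count-pos (λ _ _ _ → refl) (λ w → fromℕ< (≤-trans (s≤s z≤n) (qs≥2 w))) _

  -- Agreement with σ is agreement with σ on P and on ∁ P; both parts and f, g are then
  -- independent events in the sense of product-rule, and N² cancels.
  countGiven-product : ∀ σ {P : Fin n → Set} (P? : Decidable P) {f g : Assign n qs → Bool} →
                       DependsOnly P f → DependsOnly (∁ P) g →
                       countGiven σ (λ τ → f τ ∧ g τ) * total Φ σ ≡ countGiven σ f * countGiven σ g
  countGiven-product σ {P} P? {f} {g} f-loc g-loc = *-cancelʳ-≡ _ _ (N * N) {{>-nonZero (*-mono-< count-all-pos count-all-pos)}} (begin
    countGiven σ fg * total Φ σ * (N * N)          ≡⟨ *-interchange (countGiven σ fg) (total Φ σ) N N ⟩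
    (countGiven σ fg * N) * (total Φ σ * N)        ≡⟨ cong₂ _*_ E₁ E₂ ⟩
    (count xf * count yg) * (count x * count y)    ≡⟨ *-interchange′ (count xf) (count yg) (count x) (count y) ⟩
    (count xf * count y) * (count x * count yg)    ≡⟨ sym (cong₂ _*_ E₃ E₄) ⟩
    (countGiven σ f * N) * (countGiven σ g * N)    ≡⟨ sym (*-interchange (countGiven σ f) (countGiven σ g) N N) ⟩
    countGiven σ f * countGiven σ g * (N * N)      ∎)
    where
    open ≡-Reasoning
    N = count {n} {qs} (λ _ → true)
    fg x y xf yg : Assign n qs → Bool
    fg τ = f τ ∧ g τ
    x = agreesᵇ Φ (restrict σ P?)
    y = agreesᵇ Φ (restrict σ (∁? P?))
    xf τ = x τ ∧ f τ
    yg τ = y τ ∧ g τ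
    split : ∀ τ → agreesᵇ Φ σ τ ≡ x τ ∧ y τ
    split τ = agreesᵇ-restrict σ τ P?
    x-loc : DependsOnly P x
    x-loc = DependsOnly-mono (Assigned-restrict σ P?) (agreesᵇ-local _)
    y-loc : DependsOnly (∁ P) y
    y-loc = DependsOnly-mono (Assigned-restrict σ (∁? P?)) (agreesᵇ-local _)
    product : ∀ {f′ g′} → DependsOnly P f′ → DependsOnly (∁ P) g′ →
              count (λ τ → f′ τ ∧ g′ τ) * N ≡ count f′ * count g′
    product = product-rule n disjoint
      where
      disjoint : ∀ w → ¬ P w ⊎ ¬ ∁ P w
      disjoint w with P? w
      ... | yes Pw  = inj₂ (λ ∁Pw → ∁Pw Pw)
      ... | no  ¬Pw = inj₁ ¬Pw
    E₁ : countGiven σ fg * N ≡ count xf * count yg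
    E₁ = trans (cong (_* N) (count-cong λ τ → trans (cong (_∧ fg τ) (split τ)) (∧.interchange (x τ) (y τ) (f τ) (g τ))))
               (product (DependsOnly-∧ x-loc f-loc) (DependsOnly-∧ y-loc g-loc))
    E₂ : total Φ σ * N ≡ count x * count y
    E₂ = trans (cong (_* N) (count-cong split)) (product x-loc y-loc)
    E₃ : countGiven σ f * N ≡ count xf * count y
    E₃ = trans (cong (_* N) (count-cong λ τ → trans (cong (_∧ f τ) (split τ)) (∧.xy∙z≈xz∙y (x τ) (y τ) (f τ))))
               (product (DependsOnly-∧ x-loc f-loc) y-loc)
    E₄ : countGiven σ g * N ≡ count x * count yg
    E₄ = trans (cong (_* N) (count-cong λ τ → trans (cong (_∧ g τ) (split τ)) (∧-assoc (x τ) (y τ) (g τ))))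
               (product x-loc (DependsOnly-∧ y-loc g-loc))
    *-interchange : ∀ a b c d → a * b * (c * d) ≡ (a * c) * (b * d)
    *-interchange = solve-∀
    *-interchange′ : ∀ a b c d → (a * b) * (c * d) ≡ (a * d) * (c * b)
    *-interchange′ = solve-∀

  -- Conditioning on a fresh variable

  countGiven-update-val : ∀ {σ u} → σ u ≡ unacc → ∀ b {f : Assign n qs → Bool} → DependsOnly (_≢ u) f →
                          countGiven (update Φ σ u (val b)) f * qs u ≡ countGiven σ f
  countGiven-update-val {σ} {u} σu≡∘ b {f} f-loc =
    trans (cong (_* qs u) (count-cong λ τ → trans (cong (_∧ f τ) (agreesᵇ-update-val σu≡∘ b τ))
                                                  (∧.xy∙z≈xz∙y (agreesᵇ Φ σ τ) _ (f τ))))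
          (count-fix-coordinate u b (DependsOnly-∧ (DependsOnly-mono (λ _ → Assigned⇒≢ σu≡∘) (agreesᵇ-local σ)) f-loc))

  countGiven-update-val-≤ : ∀ {σ u} → σ u ≡ unacc → ∀ b f → countGiven (update Φ σ u (val b)) f ≤ countGiven σ f
  countGiven-update-val-≤ {σ} σu≡∘ b f = count-mono λ τ t →
    let ag , fτ = T-∧⁻ _ t in T-∧⁺ (proj₁ (T-∧⁻ (agreesᵇ Φ σ τ) (subst T (agreesᵇ-update-val σu≡∘ b τ) ag))) fτ

  countGiven-update-star : ∀ {σ u} → σ u ≡ unacc → ∀ f → countGiven (update Φ σ u star) f ≡ countGiven σ f
  countGiven-update-star σu≡∘ f = count-cong λ τ → cong (_∧ f τ) (agreesᵇ-update-star σu≡∘ τ)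

  total-update-val : ∀ {σ u} → σ u ≡ unacc → ∀ b → total Φ (update Φ σ u (val b)) * qs u ≡ total Φ σ
  total-update-val {σ} {u} σu≡∘ b = begin
    total Φ (update Φ σ u (val b)) * qs u               ≡⟨ cong (_* qs u) (total≡countGiven (update Φ σ u (val b))) ⟩
    countGiven (update Φ σ u (val b)) (λ _ → true) * qs u ≡⟨ countGiven-update-val σu≡∘ b (λ _ _ _ → refl) ⟩
    countGiven σ (λ _ → true)                       ≡⟨ sym (total≡countGiven σ) ⟩
    total Φ σ                                       ∎
    where open ≡-Reasoning

  bad-update-val : ∀ {σ u} → σ u ≡ unacc → ∀ b {c} → u ∉ₛ vbl (con c) → bad Φ c (update Φ σ u (val b)) * qs u ≡ bad Φ c σ
  bad-update-val σu≡∘ b {c} u∉c =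
    countGiven-update-val σu≡∘ b (DependsOnly-mono (λ { w w∈c refl → u∉c w∈c }) (violated-local c))

  qs≤qmax : ∀ u → qs u ≤ qmax Φ
  qs≤qmax u = ≤-foldr-⊔ qs (∈-allFin u)

  qs-nonZero : ∀ u → NonZero (qs u)
  qs-nonZero u = >-nonZero (≤-trans (s≤s z≤n) (qs≥2 u))

  ProbLe-update-val : ∀ {σ u} → σ u ≡ unacc → (∀ c → u ∈ₛ vbl (con c) → ¬ ProbGt-p' Φ c σ) →
                      ∀ b c → ProbLe-p'q Φ c σ → ProbLe-p'q Φ c (update Φ σ u (val b))
  ProbLe-update-val {σ} {u} σu≡∘ unfrozen b c σ-bounded with u ∈? vbl (con c)
  ... | yes u∈c = ·e²≤-mono (*-monoˡ-≤ (K Φ) (countGiven-update-val-≤ {σ} {u} σu≡∘ b (violated c))) total-bound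
                            (≯·e²⇒·e²≤ {bad Φ c σ * K Φ} {total Φ σ} (unfrozen c u∈c))
    where
    σ′ = update Φ σ u (val b)
    total-bound : total Φ σ ≤ qmax Φ * total Φ σ′
    total-bound = begin
      total Φ σ            ≡⟨ sym (total-update-val {σ} {u} σu≡∘ b) ⟩
      total Φ σ′ * qs u    ≤⟨ *-monoʳ-≤ (total Φ σ′) (qs≤qmax u) ⟩
      total Φ σ′ * qmax Φ  ≡⟨ *-comm (total Φ σ′) (qmax Φ) ⟩
      qmax Φ * total Φ σ′  ∎
      where open ≤-Reasoning
  ... | no u∉c = ·e²≤-cancelʳ {bad Φ c σ′ * K Φ} {qmax Φ * total Φ σ′} (qs u) {{qs-nonZero u}} (subst₂ _·e²≤_
                    (trans (cong (_* K Φ) (sym (bad-update-val {σ} {u} σu≡∘ b {c} u∉c))) (*-swapʳ (bad Φ c σ′) (qs u) (K Φ)))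
                    (trans (cong (qmax Φ *_) (sym (total-update-val {σ} {u} σu≡∘ b))) (sym (*-assoc (qmax Φ) (total Φ σ′) (qs u))))
                    σ-bounded)
    where
    σ′ = update Φ σ u (val b)
    *-swapʳ : ∀ x y z → x * y * z ≡ x * z * y
    *-swapʳ = solve-∀

  ProbLe-update-star : ∀ {σ u} → σ u ≡ unacc → ∀ c → ProbLe-p'q Φ c σ → ProbLe-p'q Φ c (update Φ σ u star)
  ProbLe-update-star {σ} {u} σu≡∘ c = subst₂ (λ b t → (b * K Φ) ·e²≤ (qmax Φ * t))
    (sym (countGiven-update-star {σ} {u} σu≡∘ (violated c)))
    (sym (count-cong {f = agreesᵇ Φ (update Φ σ u star)} (agreesᵇ-update-star σu≡∘)))

  -- The Lovász local lemma

  Meets : Fin m → Fin m → Set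
  Meets c c′ = 1 ≤ ∣ vbl (con c) ∩ vbl (con c′) ∣

  meets? : ∀ c → Decidable (Meets c)
  meets? c c′ = 1 ≤? ∣ vbl (con c) ∩ vbl (con c′) ∣

  ∈ₛ⇒∣∣-pos : ∀ {k} {x : Fin k} {p} → x ∈ₛ p → 0 < ∣ p ∣
  ∈ₛ⇒∣∣-pos {x = x} {p} x∈p =
    subst (_≤ ∣ p ∣) (∣⁅x⁆∣≡1 x) (p⊆q⇒∣p∣≤∣q∣ λ y∈⁅x⁆ → subst (_∈ₛ p) (sym (x∈⁅y⁆⇒x≡y x y∈⁅x⁆)) x∈p)

  ¬Meets⇒disjoint : ∀ {c c′ w} → ¬ Meets c c′ → w ∈ₛ vbl (con c′) → w ∉ₛ vbl (con c)
  ¬Meets⇒disjoint ¬meets w∈c′ w∈c = ¬meets (∈ₛ⇒∣∣-pos (x∈p∩q⁺ (w∈c , w∈c′)))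

  neighbours≤Δ : ∀ c → length (filter (meets? c) (allFin m)) ≤ Δmax Φ
  neighbours≤Δ c = ≤-foldr-⊔ (λ c → length (filter (meets? c) (allFin m))) (∈-allFin c)

  sat : List (Fin m) → Assign n qs → Bool
  sat L τ = all (λ c → check (con c) τ) L

  sat-local : ∀ {A : Fin n → Set} L → (∀ c → c ∈ L → DependsOnly A (check (con c))) → DependsOnly A (sat L)
  sat-local []       _     _ _ _     = refl
  sat-local (c ∷ L) L-loc τ τ′ τ≈τ′ =
    cong₂ _∧_ (L-loc c (here refl) τ τ′ τ≈τ′) (sat-local L (λ c′ → L-loc c′ ∘ there) τ τ′ τ≈τ′)

  sat-filter : ∀ {P : Fin m → Set} (P? : Decidable P) L τ → sat L τ ≡ sat (filter P? L) τ ∧ sat (filter (∁? P?) L) τ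
  sat-filter P? []      τ = refl
  sat-filter P? (c ∷ L) τ with P? c
  ... | yes _ = trans (cong (check (con c) τ ∧_) (sat-filter P? L τ)) (sym (∧-assoc (check (con c) τ) S₁ S₂))
    where S₁ = sat (filter P? L) τ ; S₂ = sat (filter (∁? P?) L) τ
  ... | no  _ = trans (cong (check (con c) τ ∧_) (sat-filter P? L τ)) (∧.x∙yz≈y∙xz (check (con c) τ) S₁ S₂)
    where S₁ = sat (filter P? L) τ ; S₂ = sat (filter (∁? P?) L) τ

  module LovászLocalLemma (ρ : PA Φ) (ρ-pos : 0 < total Φ ρ)
                          (bad-small : ∀ c → bad Φ c ρ * (4 * Δmax Φ + 4) ≤ total Φ ρ) where

    D : ℕ
    D = 4 * Δmax Φ + 4

    μ : (Assign n qs → Bool) → ℕ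
    μ = countGiven ρ

    union-bound : ∀ (B : Assign n qs → Bool) L →
                  μ B ≤ μ (λ τ → B τ ∧ sat L τ) + sum (map (λ c → μ (λ τ → violated c τ ∧ B τ)) L)
    union-bound B [] = ≤-trans (≤-reflexive (countGiven-cong ρ λ τ → sym (∧-identityʳ (B τ)))) (m≤m+n _ _)
    union-bound B (c ∷ L) = begin
      μ B                                     ≤⟨ union-bound B L ⟩
      μ (λ τ → B τ ∧ sat L τ) + Σ             ≡⟨ cong (_+ Σ) (countGiven-split ρ _ (check (con c))) ⟩
      μ (λ τ → (B τ ∧ sat L τ) ∧ check (con c) τ) + μ (λ τ → (B τ ∧ sat L τ) ∧ violated c τ) + Σ
        ≤⟨ +-monoˡ-≤ Σ (+-mono-≤ (≤-reflexive (countGiven-cong ρ λ τ → ∧.xy∙z≈x∙zy (B τ) _ _))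
                                 (countGiven-mono ρ λ τ → violated-and-B τ)) ⟩
      μ (λ τ → B τ ∧ sat (c ∷ L) τ) + μ (λ τ → violated c τ ∧ B τ) + Σ
        ≡⟨ +-assoc (μ (λ τ → B τ ∧ sat (c ∷ L) τ)) _ Σ ⟩
      μ (λ τ → B τ ∧ sat (c ∷ L) τ) + sum (map (λ c → μ (λ τ → violated c τ ∧ B τ)) (c ∷ L)) ∎
      where
      open ≤-Reasoning
      Σ = sum (map (λ c → μ (λ τ → violated c τ ∧ B τ)) L)
      violated-and-B : ∀ τ → T ((B τ ∧ sat L τ) ∧ violated c τ) → T (violated c τ ∧ B τ)
      violated-and-B τ t = let bs , v = T-∧⁻ (B τ ∧ sat L τ) t in T-∧⁺ v (proj₁ (T-∧⁻ (B τ) bs))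

    violated-independent : ∀ c {g : Assign n qs → Bool} → DependsOnly (∁ (_∈ₛ vbl (con c))) g →
                           μ (λ τ → violated c τ ∧ g τ) * D ≤ μ g
    violated-independent c {g} g-loc = *-cancelʳ-≤ _ _ (total Φ ρ) {{>-nonZero ρ-pos}} (begin
      μ (λ τ → violated c τ ∧ g τ) * D * total Φ ρ  ≡⟨ *-swapʳ (μ (λ τ → violated c τ ∧ g τ)) D (total Φ ρ) ⟩
      μ (λ τ → violated c τ ∧ g τ) * total Φ ρ * D  ≡⟨ cong (_* D) (countGiven-product ρ (_∈? vbl (con c)) (violated-local c) g-loc) ⟩
      bad Φ c ρ * μ g * D                           ≡⟨ *-swapʳ (bad Φ c ρ) (μ g) D ⟩
      bad Φ c ρ * D * μ g                           ≤⟨ *-monoˡ-≤ (μ g) (bad-small c) ⟩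
      total Φ ρ * μ g                               ≡⟨ *-comm (total Φ ρ) (μ g) ⟩
      μ g * total Φ ρ                               ∎)
      where
      open ≤-Reasoning
      *-swapʳ : ∀ x y z → x * y * z ≡ x * z * y
      *-swapʳ = solve-∀

    -- P[¬c | ⋀ L] ≤ 2 / D, the inductive invariant of the local lemma.
    Bound : List (Fin m) → Set
    Bound L = ∀ c → μ (λ τ → violated c τ ∧ sat L τ) * D ≤ 2 * μ (sat L)

    bound-step : ∀ L → L ⊆ allFin m → (∀ L′ → length L′ < length L → L′ ⊆ allFin m → Bound L′) → Bound L
    bound-step L L⊆ rec c = begin
      μ (λ τ → violated c τ ∧ sat L τ) * D  ≤⟨ *-monoˡ-≤ D (countGiven-mono ρ drop-S₁) ⟩
      μ (λ τ → violated c τ ∧ sat S₂ τ) * D ≤⟨ violated-independent c {sat S₂} (sat-local S₂ S₂-avoids-c) ⟩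
      μ (sat S₂)                            ≤⟨ union-arith {μ (sat S₂)} {μ (sat L)} {Σ} (Δmax Φ) X≤Y+Σ ΣD≤2ΔX ⟩
      2 * μ (sat L)                         ∎
      where
      open ≤-Reasoning
      -- S₁ holds the (at most Δ) constraints of L sharing a variable with c; ¬c is independent of ⋀ S₂.
      S₁ S₂ : List (Fin m)
      S₁ = filter (meets? c) L
      S₂ = filter (∁? (meets? c)) L
      Σ = sum (map (λ c′ → μ (λ τ → violated c′ τ ∧ sat S₂ τ)) S₁)
      drop-S₁ : ∀ τ → T (violated c τ ∧ sat L τ) → T (violated c τ ∧ sat S₂ τ)
      drop-S₁ τ t = let v , s = T-∧⁻ (violated c τ) t
                    in T-∧⁺ v (proj₂ (T-∧⁻ (sat S₁ τ) (subst T (sat-filter (meets? c) L τ) s)))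
      S₂-avoids-c : ∀ c′ → c′ ∈ S₂ → DependsOnly (∁ (_∈ₛ vbl (con c))) (check (con c′))
      S₂-avoids-c c′ c′∈S₂ τ τ′ τ≈τ′ = local (con c′) τ τ′ λ w w∈c′ →
        τ≈τ′ w (¬Meets⇒disjoint (proj₂ (∈-filter⁻ (∁? (meets? c)) {xs = L} c′∈S₂)) w∈c′)
      X≤Y+Σ : μ (sat S₂) ≤ μ (sat L) + Σ
      X≤Y+Σ = subst (μ (sat S₂) ≤_) (cong (_+ Σ) (countGiven-cong ρ λ τ →
                trans (∧-comm (sat S₂ τ) (sat S₁ τ)) (sym (sat-filter (meets? c) L τ))))
                (union-bound (sat S₂) S₁)
      ΣD≤2ΔX : Σ * D ≤ Δmax Φ * (2 * μ (sat S₂))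
      ΣD≤2ΔX = begin
        Σ * D                           ≤⟨ sum-map-*-≤ _ S₁ (λ c′ c′∈S₁ → rec S₂ (shorter c′∈S₁) S₂⊆ c′) ⟩
        length S₁ * (2 * μ (sat S₂))    ≤⟨ *-monoˡ-≤ _ S₁≤Δ ⟩
        Δmax Φ * (2 * μ (sat S₂))       ∎
        where
        S₁≤Δ : length S₁ ≤ Δmax Φ
        S₁≤Δ = ≤-trans (length-mono-≤ (filter⁺ (meets? c) (meets? c) (λ { refl → id }) L⊆)) (neighbours≤Δ c)
        S₂⊆ : S₂ ⊆ allFin m
        S₂⊆ = ⊆-trans (filter-⊆ (∁? (meets? c)) L) L⊆
        shorter : ∀ {c′} → c′ ∈ S₁ → length S₂ < length L
        shorter c′∈S₁ = let c′∈L , meets = ∈-filter⁻ (meets? c) {xs = L} c′∈S₁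
                        in filter-notAll (∁? (meets? c)) L (Any.map (λ { refl ¬meets → ¬meets meets }) c′∈L)

    bound : ∀ L → L ⊆ allFin m → Bound L
    bound = WF.All.wfRec (On.wellFounded length <-wellFounded) _ (λ L → L ⊆ allFin m → Bound L)
                         (λ L rec L⊆ → bound-step L L⊆ (λ L′ L′<L → rec {L′} L′<L))

    sat-pos : ∀ L → L ⊆ allFin m → 0 < μ (sat L)
    sat-pos []      _    = subst (0 <_) (total≡countGiven ρ) ρ-pos
    sat-pos (c ∷ L) c∷L⊆ = positivity-arith (Δmax Φ) (subst (0 <_) split (sat-pos L L⊆))
                                             (subst (λ k → Z * D ≤ 2 * k) split (bound L L⊆ c))
      where
      L⊆ = ∷ˡ⁻ c∷L⊆
      W = μ (sat (c ∷ L))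
      Z = μ (λ τ → violated c τ ∧ sat L τ)
      split : μ (sat L) ≡ W + Z
      split = trans (countGiven-split ρ (sat L) (check (con c)))
                    (cong₂ _+_ (countGiven-cong ρ λ τ → ∧-comm (sat L τ) _) (countGiven-cong ρ λ τ → ∧-comm (sat L τ) _))

    feasible : Feasible Φ ρ
    feasible =
      let τ , t  = countᵇ-witness _ (allAssign n qs) (sat-pos (allFin m) ⊆-refl)
          ag , s = T-∧⁻ (agreesᵇ Φ ρ τ) t
      in τ , (λ c → Equivalence.to T-≡ (All.lookup (T-all⇒All _ (allFin m) s) (∈-allFin c)))
           , agreesᵇ-sound ag

  bad*D≤total : ∀ {τ c ρ} → Satisfies Φ τ → ProbLe-p'q Φ c ρ → bad Φ c ρ * (4 * Δmax Φ + 4) ≤ total Φ ρ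
  bad*D≤total {τ} {c} {ρ} τ-sat bounded with nonempty? (vbl (con c))
  ... | no empty = ≤-trans (≤-reflexive (cong (_* _) bad≡0)) z≤n
    where
    never-violated : ∀ τ′ → T (violated c τ′) → T false
    never-violated τ′ = subst (T ∘ not) (trans (local (con c) τ′ τ λ w w∈c → ⊥-elim (empty (w , w∈c))) (τ-sat c))
    bad≡0 : bad Φ c ρ ≡ 0
    bad≡0 = n≤0⇒n≡0 (≤-trans (countGiven-mono ρ never-violated) (≤-reflexive (count-∧-const (agreesᵇ Φ ρ) false)))
  ... | yes (w , w∈c) = *-cancelʳ-≤ _ _ (qmax Φ) {{>-nonZero q≥1}} (begin
    bad Φ c ρ * D * qmax Φ       ≡⟨ *-assoc (bad Φ c ρ) D (qmax Φ) ⟩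
    bad Φ c ρ * (D * qmax Φ)     ≤⟨ *-monoʳ-≤ (bad Φ c ρ) (4Δ+4≤K (qmax Φ) (kmax Φ) (Δmax Φ) q≥1 k≥1 Δ≥1) ⟩
    bad Φ c ρ * (K Φ * 4)        ≡⟨ sym (*-assoc (bad Φ c ρ) (K Φ) 4) ⟩
    bad Φ c ρ * K Φ * 4          ≤⟨ ·e²≤⇒*4≤ {bad Φ c ρ * K Φ} {qmax Φ * total Φ ρ} bounded ⟩
    qmax Φ * total Φ ρ           ≡⟨ *-comm (qmax Φ) (total Φ ρ) ⟩
    total Φ ρ * qmax Φ           ∎)
    where
    open ≤-Reasoning
    D = 4 * Δmax Φ + 4
    q≥1 : 1 ≤ qmax Φ
    q≥1 = ≤-trans (s≤s z≤n) (≤-trans (qs≥2 w) (qs≤qmax w))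
    k≥1 : 1 ≤ kmax Φ
    k≥1 = ≤-trans (∈ₛ⇒∣∣-pos w∈c) (≤-foldr-⊔ (λ c → ∣ vbl (con c) ∣) (∈-allFin c))
    Δ≥1 : 1 ≤ Δmax Φ
    Δ≥1 = ≤-trans (∈⇒length-pos (∈-filter⁺ (meets? c) (∈-allFin c) (∈ₛ⇒∣∣-pos (x∈p∩q⁺ (w∈c , w∈c)))))
                  (neighbours≤Δ c)

  update-preserves : ∀ {σ u} → σ u ≡ unacc → (∀ c → u ∈ₛ vbl (con c) → ¬ ProbGt-p' Φ c σ) →
                     Feasible Φ σ → (∀ c → ProbLe-p'q Φ c σ) → ∀ a → a ≢ unacc →
                     Feasible Φ (update Φ σ u a) × (∀ c → ProbLe-p'q Φ c (update Φ σ u a))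
  update-preserves {σ} {u} σu≡∘ unfrozen (τ , τ-sat , τ-agrees) bounded (val b) _ =
    LovászLocalLemma.feasible σ′ σ′-pos (λ c → bad*D≤total {τ} {c} {σ′} τ-sat (bounded′ c)) , bounded′
    where
    σ′ = update Φ σ u (val b)
    bounded′ : ∀ c → ProbLe-p'q Φ c σ′
    bounded′ c = ProbLe-update-val σu≡∘ unfrozen b c (bounded c)
    σ-pos : 0 < total Φ σ
    σ-pos = count-pos (DependsOnly⇒Extensional (agreesᵇ-local σ)) τ (agreesᵇ-complete τ-agrees)
    σ′-pos : 0 < total Φ σ′
    σ′-pos = 0<m*n⇒0<m (total Φ σ′) (subst (0 <_) (sym (total-update-val {σ} {u} σu≡∘ b)) σ-pos)
  update-preserves {σ} {u} σu≡∘ _ (τ , τ-sat , τ-agrees) bounded star _ =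
    (τ , τ-sat , agreesᵇ-sound (subst T (sym (agreesᵇ-update-star σu≡∘ τ)) (agreesᵇ-complete τ-agrees))) ,
    λ c → ProbLe-update-star σu≡∘ c (bounded c)
  update-preserves _ _ _ _ unacc unacc≢unacc = ⊥-elim (unacc≢unacc refl)

  unfixed⇒unaccessed : ∀ {O σ u} → ¬ Fixed Φ O σ u → σ u ≡ unacc
  unfixed⇒unaccessed {σ = σ} {u} ¬fixed = ≡unacc-stable (σ u) (¬fixed ∘ inj₁)

  unfixed⇒unfrozen : ∀ {O σ u} → ¬ Fixed Φ O σ u → ∀ c → u ∈ₛ vbl (con c) → ¬ ProbGt-p' Φ c σ
  unfixed⇒unfrozen {O} {σ} ¬fixed c u∈c gt = ¬fixed (inj₂ (c , Oracle.yes-sound O c σ gt , u∈c))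

lemma5p9 : (Φ : CSP) (O : Oracle Φ) (σ : PA Φ) (v : Fin (CSP.n Φ)) →
           Feasible Φ σ → σ v ≡ star → (∀ c → ProbLe-p'q Φ c σ) →
           (u : Fin (CSP.n Φ)) → ¬ Fixed Φ O σ u →
           (a : PVal (CSP.qs Φ u)) → a ≢ unacc →
           Feasible Φ (update Φ σ u a) × (update Φ σ u a v ≡ star) ×
           (∀ c → ProbLe-p'q Φ c (update Φ σ u a))
lemma5p9 Φ O σ v feasible σv≡⋆ bounded u ¬fixed a a≢∘ =
  let feasible′ , bounded′ = update-preserves Φ {σ} {u} σu≡∘ (unfixed⇒unfrozen Φ {O} {σ} {u} ¬fixed) feasible bounded a a≢∘
  in feasible′ , trans (update-≢ Φ σ u a v≢u) σv≡⋆ , bounded′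
  where
  σu≡∘ : σ u ≡ unacc
  σu≡∘ = unfixed⇒unaccessed Φ {O} {σ} {u} ¬fixed
  v≢u : v ≢ u
  v≢u refl = case trans (sym σv≡⋆) σu≡∘ of λ ()
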